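{- Let $\wp \geq 3$ be an integer and let $T_{\wp}\langle 1, \wp-2\rangle$ be the Toeplitz graph on $\{1,\dots,\wp\}$ with generating set $\{1,\wp-2\}$. If $\wp$ is odd, then $\mathrm{ldim}_{\mathrm{f}}(T_{\wp}\langle 1, \wp-2\rangle)=1$. If $\wp$ is even, then $$\frac{\wp}{\wp-1}\leq \mathrm{ldim}_{\mathrm{f}}(T_{\wp}\langle 1, \wp-2\rangle)\leq \frac{\wp}{\wp-2}.$$
   Context: For a positive integer $n$ and $S\subseteq\{1,\dots,n\}$, the Toeplitz graph $T_n\langle S\rangle$ has vertex set $\{1,2,\dots,n\}$, and distinct vertices $p,q$ are adjacent iff $|p-q|\in S$. For a finite simple graph $G$ with shortest-path distance $d$, and vertices $v,w$, the resolving neighborhood is $\mathcal{R}\{v,w\}=\{u\in V(G): d(u,v)\neq d(u,w)\}$. A local resolving function of $G$ is a map $\zeta:V(G)\to[0,1]$ such that $\sum_{u\in\mathcal{R}\{v,w\}}\zeta(u)\geq 1$ for every edge $vw$ of $G$. The local fractional metric dimension is $\mathrm{ldim}_{\mathrm{f}}(G)=\min\{\sum_{v\in V(G)}\zeta(v): \zeta \text{ a local resolving function of } G\}$.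
   Formalization: Local resolving functions take values in the rationals of $[0,1]$ rather than in the real interval $[0,1]$. -}

module Defs where

open import Data.Bool using (Bool; true; false; _∧_; _∨_; not; if_then_else_)
open import Data.Nat using (ℕ; zero; suc; _∸_; ∣_-_∣; _≡ᵇ_)
open import Data.Fin using (Fin; toℕ)
open import Data.List using (List; []; _∷_)
open import Data.Bool.ListAction using (any)
open import Data.Rational using (ℚ; 0ℚ; 1ℚ; _+_; _≤_; _/_)
open import Data.Integer using (+_)
open import Data.Product using (Σ; _×_)
open import Relation.Binary.PropositionalEquality using (_≡_)

record Graph (n : ℕ) : Set where
  field
    adj : Fin n → Fin n → Bool
open Graph public

memℕ : ℕ → List ℕ → Bool
memℕ d []      = false
memℕ d (x ∷ s) = (d ≡ᵇ x) ∨ memℕ d s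

-- Toeplitz graph T_n⟨S⟩: vertex i : Fin n stands for the integer (toℕ i + 1);
-- distinct p, q adjacent iff |p - q| ∈ S.
Toeplitz : (n : ℕ) → List ℕ → Graph n
Toeplitz n S = record { adj = λ i j →
  not (toℕ i ≡ᵇ toℕ j) ∧ memℕ ∣ toℕ i - toℕ j ∣ S }

allV : (n : ℕ) → List (Fin n)
allV zero    = []
allV (suc n) = Fin.zero ∷ Data.List.map Fin.suc (allV n)
  where import Data.Fin as Fin

within : {n : ℕ} → Graph n → ℕ → Fin n → Fin n → Bool
within {n} G zero    u v = toℕ u ≡ᵇ toℕ v
within {n} G (suc k) u v =
  within G k u v ∨ any (λ w → within G k u w ∧ adj G w v) (allV n)

-- Any finite distance in a graph on n vertices is ≤ n - 1, so the value n
-- plays the role of "∞" (unreachable); comparisons of distances are exact.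
searchDist : {n : ℕ} → Graph n → Fin n → Fin n → ℕ → ℕ → ℕ
searchDist G u v k zero    = k
searchDist G u v k (suc f) =
  if within G k u v then k else searchDist G u v (suc k) f

dist : {n : ℕ} → Graph n → Fin n → Fin n → ℕ
dist {n} G u v = searchDist G u v 0 n

resolves : {n : ℕ} → Graph n → Fin n → Fin n → Fin n → Bool
resolves G u v w = not (dist G u v ≡ᵇ dist G u w)

sumL : {A : Set} → (A → ℚ) → List A → ℚ
sumL f []      = 0ℚ
sumL f (x ∷ xs) = f x + sumL f xs

total : {n : ℕ} → (Fin n → ℚ) → ℚ
total {n} ζ = sumL ζ (allV n)

resSum : {n : ℕ} → Graph n → (Fin n → ℚ) → Fin n → Fin n → ℚ
resSum {n} G ζ v w = sumL (λ u → if resolves G u v w then ζ u else 0ℚ) (allV n)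

IsLocalResolving : {n : ℕ} → Graph n → (Fin n → ℚ) → Set
IsLocalResolving {n} G ζ =
  ((u : Fin n) → (0ℚ ≤ ζ u) × (ζ u ≤ 1ℚ)) ×
  ((v w : Fin n) → adj G v w ≡ true → 1ℚ ≤ resSum G ζ v w)

LdimFEq : {n : ℕ} → Graph n → ℚ → Set
LdimFEq {n} G x =
  Σ (Fin n → ℚ) (λ ζ → IsLocalResolving G ζ × (total ζ ≡ x)) ×
  ((ζ : Fin n → ℚ) → IsLocalResolving G ζ → x ≤ total ζ)

LdimFGeq : {n : ℕ} → Graph n → ℚ → Set
LdimFGeq {n} G x = (ζ : Fin n → ℚ) → IsLocalResolving G ζ → x ≤ total ζ

LdimFLeq : {n : ℕ} → Graph n → ℚ → Set
LdimFLeq {n} G x = Σ (Fin n → ℚ) (λ ζ → IsLocalResolving G ζ × (total ζ ≤ x))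

-- the rational a / b (only used with b ≥ 1; returns 0 for b = 0)
frac : ℕ → ℕ → ℚ
frac a zero    = 0ℚ
frac a (suc b) = (+ a) / suc b

-- Label the vertices 0, …, M, where p = M + 1. The edges of difference 1 together with
-- {0, M - 1} form a cycle C_M on 0, …, M - 1, and the last vertex M (the apex) is joined
-- exactly to 1 and M - 1, the neighbours of 0: it is a twin of 0. So distances are cycle
-- distances, with the apex behaving as a copy of 0 (and at distance 2 from 0).
-- If p is odd the cycle is even, the distance from 0 changes along every edge, and 0
-- alone resolves all edges: ldim_f = 1. If p is even the cycle is odd: an edge is
-- resolved by every vertex except its antipode on the cycle and possibly the apex, so
-- the constant 1/(p-2) is a local resolving function; conversely each vertex misses the
-- edge opposite to it, and double counting gives total weight ≥ p/(p-1).
module Submission where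

open import Defs
open import Data.Bool using (true; false; T; not; if_then_else_)
open import Data.Bool.Properties using (T-∨; T-∧; T-≡)
open import Data.Fin using (Fin; toℕ; fromℕ<)
import Data.Fin as Fin
open import Data.Fin.Properties using (toℕ-injective; toℕ-fromℕ<; toℕ<n)
open import Data.List using (List; []; _∷_; map; length)
open import Data.List.Properties using (length-map)
open import Data.List.Membership.Propositional using (_∈_; lose)
open import Data.List.Membership.Propositional.Properties using (∈-map⁺)
open import Data.List.Relation.Unary.Any using (here; there; satisfied)
open import Data.List.Relation.Unary.Any.Properties using (any⁺; any⁻)
open import Data.Nat using (ℕ; zero; suc; _≡ᵇ_)
open import Data.Nat.Properties using (≡ᵇ⇒≡; ≡⇒≡ᵇ)
open import Data.Product using (∃-syntax; _×_; _,_; proj₁; proj₂)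
open import Data.Rational using (1ℚ)
open import Data.Sum using (_⊎_; inj₁; inj₂; [_,_]′)
open import Function using (_∘_; _∘′_; case_of_; Equivalence)
open import Relation.Binary.Definitions using (tri<; tri≈; tri>)
open import Relation.Binary.PropositionalEquality
open import Relation.Nullary using (¬_; contradiction; yes; no)

≢⇒≡ᵇ≡false : ∀ {m n} → m ≢ n → (m ≡ᵇ n) ≡ false
≢⇒≡ᵇ≡false {m} {n} m≢n with m ≡ᵇ n in eq
... | true  = contradiction (≡ᵇ⇒≡ m n (subst T (sym eq) _)) m≢n
... | false = refl

≡ᵇ-refl : ∀ n → (n ≡ᵇ n) ≡ true
≡ᵇ-refl zero    = refl
≡ᵇ-refl (suc n) = ≡ᵇ-refl n

∈-allV : ∀ {n} (i : Fin n) → i ∈ allV n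
∈-allV Fin.zero    = here refl
∈-allV (Fin.suc i) = there (∈-map⁺ Fin.suc (∈-allV i))

length-allV : ∀ n → length (allV n) ≡ n
length-allV zero    = refl
length-allV (suc n) = cong suc (trans (length-map Fin.suc (allV n)) (length-allV n))

module Weights where

  import Data.Nat as ℕ
  import Data.Nat.Properties as ℕ
  open import Data.Integer using (+_)
  import Data.Integer as ℤ
  import Data.Integer.Properties as ℤ
  open import Data.Integer.Solver using (module +-*-Solver)
  open import Data.Rational
  open import Data.Rational.Properties
  import Data.Rational.Solver as ℚ-Solver
  import Data.Rational.Unnormalised as ℚᵘ
  open ℚᵘ using (mkℚᵘ; *≡*) renaming (_≃_ to _≃ᵘ_)
  import Data.Rational.Unnormalised.Properties as ℚᵘ

  fromℕ : ℕ → ℚ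
  fromℕ n = + n / 1

  toℚᵘ-/ : ∀ a d → toℚᵘ (+ a / suc d) ≃ᵘ mkℚᵘ (+ a) d
  toℚᵘ-/ a d = toℚᵘ-fromℚᵘ (mkℚᵘ (+ a) d)

  module _ where
    open +-*-Solver
    open ℚᵘ.≃-Reasoning

    fromℕ-suc : ∀ n → fromℕ (suc n) ≡ 1ℚ + fromℕ n
    fromℕ-suc n = toℚᵘ-injective (begin
      toℚᵘ (fromℕ (suc n))                  ≈⟨ toℚᵘ-/ (suc n) 0 ⟩
      mkℚᵘ (+ suc n) 0                      ≈⟨ *≡* (trans
          (cong (ℤ._* + 1) (ℤ.pos-+ 1 n))
          (solve 1 (λ x → (con (+ 1) :+ x) :* con (+ 1) := (con (+ 1) :* con (+ 1) :+ x :* con (+ 1)) :* con (+ 1))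
                 refl (+ n))) ⟩
      mkℚᵘ (+ 1) 0 ℚᵘ.+ mkℚᵘ (+ n) 0        ≈⟨ ℚᵘ.+-cong (toℚᵘ-/ 1 0) (toℚᵘ-/ n 0) ⟨
      toℚᵘ 1ℚ ℚᵘ.+ toℚᵘ (fromℕ n)           ≈⟨ toℚᵘ-homo-+ 1ℚ (fromℕ n) ⟨
      toℚᵘ (1ℚ + fromℕ n)                   ∎)

    fromℕ-*-/ : ∀ a d → fromℕ (suc d) * (+ a / suc d) ≡ fromℕ a
    fromℕ-*-/ a d = toℚᵘ-injective (begin
      toℚᵘ (fromℕ (suc d) * (+ a / suc d))         ≈⟨ toℚᵘ-homo-* (fromℕ (suc d)) (+ a / suc d) ⟩
      toℚᵘ (fromℕ (suc d)) ℚᵘ.* toℚᵘ (+ a / suc d) ≈⟨ ℚᵘ.*-cong (toℚᵘ-/ (suc d) 0) (toℚᵘ-/ a d) ⟩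
      mkℚᵘ (+ suc d) 0 ℚᵘ.* mkℚᵘ (+ a) d           ≈⟨ *≡* (trans
          (solve 2 (λ x y → (x :* y) :* con (+ 1) := y :* x) refl (+ suc d) (+ a))
          (cong (λ k → + a ℤ.* + suc k) (sym (ℕ.+-identityʳ d)))) ⟩
      mkℚᵘ (+ a) 0                                  ≈⟨ toℚᵘ-/ a 0 ⟨
      toℚᵘ (fromℕ a)                                ∎)

    fromℕ-*-1/ : ∀ a d → fromℕ a * (+ 1 / suc d) ≡ + a / suc d
    fromℕ-*-1/ a d = toℚᵘ-injective (begin
      toℚᵘ (fromℕ a * (+ 1 / suc d))               ≈⟨ toℚᵘ-homo-* (fromℕ a) (+ 1 / suc d) ⟩
      toℚᵘ (fromℕ a) ℚᵘ.* toℚᵘ (+ 1 / suc d)       ≈⟨ ℚᵘ.*-cong (toℚᵘ-/ a 0) (toℚᵘ-/ 1 d) ⟩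
      mkℚᵘ (+ a) 0 ℚᵘ.* mkℚᵘ (+ 1) d               ≈⟨ *≡* (trans
          (solve 2 (λ x y → (x :* con (+ 1)) :* y := x :* y) refl (+ a) (+ suc d))
          (cong (λ k → + a ℤ.* + suc k) (sym (ℕ.+-identityʳ d)))) ⟩
      mkℚᵘ (+ a) d                                  ≈⟨ toℚᵘ-/ a d ⟨
      toℚᵘ (+ a / suc d)                            ∎)

  fromℕ-pos : ∀ n → Positive (fromℕ (suc n))
  fromℕ-pos n = normalize-pos (suc n) 1

  0≤1/[1+d] : ∀ d → 0ℚ ≤ + 1 / suc d
  0≤1/[1+d] d = nonNegative⁻¹ _ {{normalize-nonNeg 1 (suc d)}}

  1/[1+d]≤1 : ∀ d → + 1 / suc d ≤ 1ℚ
  1/[1+d]≤1 d = toℚᵘ-cancel-≤ (ℚᵘ.≤-respˡ-≃ (ℚᵘ.≃-sym (toℚᵘ-/ 1 d)) (ℚᵘ.*≤* (ℤ.+≤+ (ℕ.s≤s ℕ.z≤n))))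

  +-cancelʳ-≤ : ∀ x y z → x + z ≤ y + z → x ≤ y
  +-cancelʳ-≤ x y z x+z≤y+z = begin
    x          ≡⟨ x+z-z≡x x ⟨
    x + z - z  ≤⟨ +-monoˡ-≤ (- z) x+z≤y+z ⟩
    y + z - z  ≡⟨ x+z-z≡x y ⟩
    y          ∎
    where
      open ≤-Reasoning
      x+z-z≡x : ∀ x → x + z - z ≡ x
      x+z-z≡x x = trans (+-assoc x z (- z)) (trans (cong (λ w → x + w) (+-inverseʳ z)) (+-identityʳ x))

  sumL-mono : ∀ {A : Set} {f g : A → ℚ} (xs : List A) → (∀ x → f x ≤ g x) → sumL f xs ≤ sumL g xs
  sumL-mono []       f≤g = ≤-refl
  sumL-mono (x ∷ xs) f≤g = +-mono-≤ (f≤g x) (sumL-mono xs f≤g)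

  sumL-+ : ∀ {A : Set} (f g : A → ℚ) xs → sumL (λ x → f x + g x) xs ≡ sumL f xs + sumL g xs
  sumL-+ f g []       = refl
  sumL-+ f g (x ∷ xs) = trans (cong (λ s → (f x + g x) + s) (sumL-+ f g xs))
    (solve 4 (λ a b c d → (a :+ b) :+ (c :+ d) := (a :+ c) :+ (b :+ d)) refl (f x) (g x) (sumL f xs) (sumL g xs))
    where open ℚ-Solver.+-*-Solver

  sumL-0 : ∀ {A : Set} (xs : List A) → sumL (λ _ → 0ℚ) xs ≡ 0ℚ
  sumL-0 []       = refl
  sumL-0 (x ∷ xs) = trans (+-identityˡ _) (sumL-0 xs)

  sumL-swap : ∀ {A B : Set} (f : A → B → ℚ) xs ys →
              sumL (λ x → sumL (f x) ys) xs ≡ sumL (λ y → sumL (λ x → f x y) xs) ys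
  sumL-swap f []       ys = sym (sumL-0 ys)
  sumL-swap f (x ∷ xs) ys = trans (cong (λ s → sumL (f x) ys + s) (sumL-swap f xs ys))
                                  (sym (sumL-+ (f x) (λ y → sumL (λ x → f x y) xs) ys))

  sumL-*ˡ : ∀ {A : Set} k (f : A → ℚ) xs → sumL (λ x → k * f x) xs ≡ k * sumL f xs
  sumL-*ˡ k f []       = sym (*-zeroʳ k)
  sumL-*ˡ k f (x ∷ xs) = trans (cong (λ s → k * f x + s) (sumL-*ˡ k f xs)) (sym (*-distribˡ-+ k (f x) (sumL f xs)))

  sumL-map : ∀ {A B : Set} (f : B → ℚ) (g : A → B) xs → sumL f (map g xs) ≡ sumL (f ∘′ g) xs
  sumL-map f g []       = refl
  sumL-map f g (x ∷ xs) = cong (λ s → f (g x) + s) (sumL-map f g xs)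

  fromℕ-suc-* : ∀ c n → c + fromℕ n * c ≡ fromℕ (suc n) * c
  fromℕ-suc-* c n = begin
    c + fromℕ n * c           ≡⟨ cong (_+ fromℕ n * c) (*-identityˡ c) ⟨
    1ℚ * c + fromℕ n * c      ≡⟨ *-distribʳ-+ c 1ℚ (fromℕ n) ⟨
    (1ℚ + fromℕ n) * c        ≡⟨ cong (_* c) (fromℕ-suc n) ⟨
    fromℕ (suc n) * c         ∎
    where open ≡-Reasoning

  sumL-const : ∀ {A : Set} c (xs : List A) → sumL (λ _ → c) xs ≡ fromℕ (length xs) * c
  sumL-const c []       = sym (*-zeroˡ c)
  sumL-const c (x ∷ xs) = trans (cong (λ s → c + s) (sumL-const c xs)) (fromℕ-suc-* c (length xs))

  sumL-nonneg : ∀ {A : Set} {f : A → ℚ} xs → (∀ x → 0ℚ ≤ f x) → 0ℚ ≤ sumL f xs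
  sumL-nonneg xs f≥0 = ≤-trans (≤-reflexive (sym (sumL-0 xs))) (sumL-mono xs f≥0)

  sumL-≥-term : ∀ {A : Set} {f : A → ℚ} {x xs} → (∀ y → 0ℚ ≤ f y) → x ∈ xs → f x ≤ sumL f xs
  sumL-≥-term {f = f} {x} {_ ∷ xs} f≥0 (here refl) = begin
    f x              ≡⟨ +-identityʳ (f x) ⟨
    f x + 0ℚ         ≤⟨ +-monoʳ-≤ (f x) (sumL-nonneg xs f≥0) ⟩
    f x + sumL f xs  ∎
    where open ≤-Reasoning
  sumL-≥-term {f = f} {x} {y ∷ xs} f≥0 (there x∈xs) = begin
    f x              ≡⟨ +-identityˡ (f x) ⟨
    0ℚ + f x         ≤⟨ +-mono-≤ (f≥0 y) (sumL-≥-term f≥0 x∈xs) ⟩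
    f y + sumL f xs  ∎
    where open ≤-Reasoning

  sumL-≤-missing-term : ∀ {A : Set} {f : A → ℚ} {c x xs} → x ∈ xs → f x ≡ 0ℚ → (∀ y → f y ≤ c) →
                sumL f xs ≤ fromℕ (ℕ.pred (length xs)) * c
  sumL-≤-missing-term {f = f} {c} {_} {_ ∷ xs} (here refl) fx≡0 f≤c = begin
    f _ + sumL f xs          ≡⟨ cong (_+ sumL f xs) fx≡0 ⟩
    0ℚ + sumL f xs           ≡⟨ +-identityˡ _ ⟩
    sumL f xs                ≤⟨ sumL-mono xs f≤c ⟩
    sumL (λ _ → c) xs        ≡⟨ sumL-const c xs ⟩
    fromℕ (length xs) * c    ∎
    where open ≤-Reasoning
  sumL-≤-missing-term {f = f} {c} {_} {y ∷ z ∷ zs} (there x∈xs) fx≡0 f≤c = begin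
    f y + sumL f (z ∷ zs)                 ≤⟨ +-mono-≤ (f≤c y) (sumL-≤-missing-term x∈xs fx≡0 f≤c) ⟩
    c + fromℕ (length zs) * c              ≡⟨ fromℕ-suc-* c (length zs) ⟩
    fromℕ (suc (length zs)) * c            ∎
    where open ≤-Reasoning

  sumL-indicator-≤ : ∀ n X {c} → 0ℚ ≤ c → sumL (λ (u : Fin n) → if toℕ u ≡ᵇ X then c else 0ℚ) (allV n) ≤ c
  sumL-indicator-≤ zero    X       c≥0 = c≥0
  sumL-indicator-≤ (suc n) zero    {c} c≥0 = ≤-reflexive (trans
    (cong (λ s → c + s) (trans (sumL-map _ Fin.suc (allV n)) (sumL-0 (allV n)))) (+-identityʳ c))
  sumL-indicator-≤ (suc n) (suc X) c≥0 = ≤-trans (≤-reflexive (trans (+-identityˡ _) (sumL-map _ Fin.suc (allV n))))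
    (sumL-indicator-≤ n X c≥0)

  if-nonneg : ∀ b {x} → 0ℚ ≤ x → 0ℚ ≤ (if b then x else 0ℚ)
  if-nonneg true  x≥0 = x≥0
  if-nonneg false _   = ≤-refl

  if-≤ : ∀ b {x} → 0ℚ ≤ x → (if b then x else 0ℚ) ≤ x
  if-≤ true  _   = ≤-refl
  if-≤ false x≥0 = x≥0

  0≤1 : 0ℚ ≤ 1ℚ
  0≤1 = nonNegative⁻¹ 1ℚ

  module _ {n} (G : Graph n) where

    resolves-≢ : ∀ {u v w} → dist G u v ≢ dist G u w → resolves G u v w ≡ true
    resolves-≢ ne = cong not (≢⇒≡ᵇ≡false ne)

    resolves≡false⇒ : ∀ {u v w} → resolves G u v w ≡ false → dist G u v ≡ dist G u w
    resolves≡false⇒ {u} {v} {w} eq with dist G u v ≡ᵇ dist G u w in eq′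
    ... | true = ≡ᵇ⇒≡ _ _ (subst T (sym eq′) _)

    resolves-≡ : ∀ {u v w} → dist G u v ≡ dist G u w → resolves G u v w ≡ false
    resolves-≡ {u} {v} {w} eq rewrite eq = cong not (≡ᵇ-refl (dist G u w))

    ldimF≡1 : ∀ u {v w} → T (adj G v w) → (∀ v w → T (adj G v w) → dist G u v ≢ dist G u w) → LdimFEq G 1ℚ
    ldimF≡1 u {v} {w} v~w u-resolves = (δ , (range , edges) , total≡1) , lower
      where
        δ : Fin n → ℚ
        δ u′ = if toℕ u′ ≡ᵇ toℕ u then 1ℚ else 0ℚ

        δu≡1 : δ u ≡ 1ℚ
        δu≡1 rewrite ≡ᵇ-refl (toℕ u) = refl

        δ≥0 : ∀ u′ → 0ℚ ≤ δ u′
        δ≥0 u′ = if-nonneg (toℕ u′ ≡ᵇ toℕ u) 0≤1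

        range : ∀ u′ → 0ℚ ≤ δ u′ × δ u′ ≤ 1ℚ
        range u′ = δ≥0 u′ , if-≤ (toℕ u′ ≡ᵇ toℕ u) 0≤1

        edges : ∀ v w → adj G v w ≡ true → 1ℚ ≤ resSum G δ v w
        edges v w v~w = begin
          1ℚ                                       ≡⟨ δu≡1 ⟨
          δ u                                      ≡⟨ cong (λ b → if b then δ u else 0ℚ) u-resolves-vw ⟨
          (if resolves G u v w then δ u else 0ℚ)   ≤⟨ sumL-≥-term (λ u′ → if-nonneg (resolves G u′ v w) (δ≥0 u′)) (∈-allV u) ⟩
          resSum G δ v w                           ∎
          where
            open ≤-Reasoning
            u-resolves-vw = resolves-≢ (u-resolves v w (Equivalence.from T-≡ v~w))

        total≡1 : total δ ≡ 1ℚ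
        total≡1 = ≤-antisym (sumL-indicator-≤ n (toℕ u) 0≤1)
                            (≤-trans (≤-reflexive (sym δu≡1)) (sumL-≥-term δ≥0 (∈-allV u)))

        lower : ∀ ζ → IsLocalResolving G ζ → 1ℚ ≤ total ζ
        lower ζ (ζ-range , ζ-resolving) = ≤-trans (ζ-resolving v w (Equivalence.to T-≡ v~w))
          (sumL-mono (allV n) (λ u′ → if-≤ (resolves G u′ v w) (proj₁ (ζ-range u′))))

  ldimF≥n/[n∸1] : ∀ {m} (G : Graph (suc (suc m))) →
                  (∀ u → ∃[ v ] ∃[ w ] T (adj G v w) × dist G u v ≡ dist G u w) →
                  LdimFGeq G (frac (suc (suc m)) (suc m))
  ldimF≥n/[n∸1] {m} G unresolved ζ (range , edges) = *-cancelˡ-≤-pos (fromℕ (suc m)) {{fromℕ-pos m}} (begin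
    fromℕ (suc m) * frac n (suc m)                        ≡⟨ fromℕ-*-/ n m ⟩
    fromℕ n                                               ≡⟨ *-identityʳ (fromℕ n) ⟨
    fromℕ n * 1ℚ                                          ≡⟨ cong (λ k → fromℕ k * 1ℚ) (length-allV n) ⟨
    fromℕ (length (allV n)) * 1ℚ                          ≡⟨ sumL-const 1ℚ (allV n) ⟨
    sumL (λ _ → 1ℚ) (allV n)                              ≤⟨ sumL-mono (allV n) chosen-edge-resolved ⟩
    sumL (λ u′ → sumL (λ u → g u′ u) (allV n)) (allV n)   ≡⟨ sumL-swap g (allV n) (allV n) ⟩
    sumL (λ u → sumL (λ u′ → g u′ u) (allV n)) (allV n)   ≤⟨ sumL-mono (allV n) count ⟩
    sumL (λ u → fromℕ (suc m) * ζ u) (allV n)             ≡⟨ sumL-*ˡ (fromℕ (suc m)) ζ (allV n) ⟩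
    fromℕ (suc m) * total ζ                               ∎)
    where
      open ≤-Reasoning
      n = suc (suc m)
      v w : Fin n → Fin n
      v u = proj₁ (unresolved u)
      w u = proj₁ (proj₂ (unresolved u))
      v~w : ∀ u → T (adj G (v u) (w u))
      v~w u = proj₁ (proj₂ (proj₂ (unresolved u)))

      chosen-edge-resolved : ∀ u′ → 1ℚ ≤ resSum G ζ (v u′) (w u′)
      chosen-edge-resolved u′ = edges (v u′) (w u′) (Equivalence.to T-≡ (v~w u′))

      u-misses : ∀ u → dist G u (v u) ≡ dist G u (w u)
      u-misses u = proj₂ (proj₂ (proj₂ (unresolved u)))

      g : Fin n → Fin n → ℚ
      g u′ u = if resolves G u (v u′) (w u′) then ζ u else 0ℚ

      -- u misses the edge chosen for itself, so it is counted at most n - 1 times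
      count : ∀ u → sumL (λ u′ → g u′ u) (allV n) ≤ fromℕ (suc m) * ζ u
      count u = ≤-trans
        (sumL-≤-missing-term (∈-allV u) (cong (λ b → if b then ζ u else 0ℚ) (resolves-≡ G {u} (u-misses u)))
                             (λ u′ → if-≤ (resolves G u (v u′) (w u′)) (proj₁ (range u))))
        (≤-reflexive (cong (λ k → fromℕ (ℕ.pred k) * ζ u) (length-allV n)))

  indicator-≥ : ∀ {a X c} → a ≡ X → c ≤ (if a ≡ᵇ X then c else 0ℚ)
  indicator-≥ {a} refl rewrite ≡ᵇ-refl a = ≤-refl

  covered : ∀ b {a X Y c} → 0ℚ ≤ c → (b ≡ false → a ≡ X ⊎ a ≡ Y) →
            c ≤ (if b then c else 0ℚ) + ((if a ≡ᵇ X then c else 0ℚ) + (if a ≡ᵇ Y then c else 0ℚ))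
  covered true {a} {X} {Y} {c} c≥0 _ = begin
    c                  ≡⟨ +-identityʳ c ⟨
    c + 0ℚ             ≤⟨ +-monoʳ-≤ c (+-mono-≤ (if-nonneg (a ≡ᵇ X) c≥0) (if-nonneg (a ≡ᵇ Y) c≥0)) ⟩
    c + (IX + IY)      ∎
    where
      open ≤-Reasoning
      IX = if a ≡ᵇ X then c else 0ℚ
      IY = if a ≡ᵇ Y then c else 0ℚ
  covered false {a} {X} {Y} {c} c≥0 only = begin
    c                  ≡⟨ +-identityˡ c ⟨
    0ℚ + c             ≤⟨ +-monoʳ-≤ 0ℚ ([ at-X , at-Y ]′ (only refl)) ⟩
    0ℚ + (IX + IY)     ∎
    where
      open ≤-Reasoning
      IX = if a ≡ᵇ X then c else 0ℚ
      IY = if a ≡ᵇ Y then c else 0ℚ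
      at-X : a ≡ X → c ≤ IX + IY
      at-X a≡X = ≤-trans (≤-reflexive (sym (+-identityʳ c))) (+-mono-≤ (indicator-≥ a≡X) (if-nonneg (a ≡ᵇ Y) c≥0))
      at-Y : a ≡ Y → c ≤ IX + IY
      at-Y a≡Y = ≤-trans (≤-reflexive (sym (+-identityˡ c))) (+-mono-≤ (if-nonneg (a ≡ᵇ X) c≥0) (indicator-≥ a≡Y))

  ldimF≤n/[n∸2] : ∀ {m} (G : Graph (suc (suc (suc m)))) →
                  (∀ v w → T (adj G v w) → ∃[ X ] ∃[ Y ] ∀ u → dist G u v ≡ dist G u w → toℕ u ≡ X ⊎ toℕ u ≡ Y) →
                  LdimFLeq G (frac (suc (suc (suc m))) (suc m))
  ldimF≤n/[n∸2] {m} G exceptions = ζ , ((λ _ → 0≤c , 1/[1+d]≤1 m) , edges) , ≤-reflexive total≡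
    where
      n = suc (suc (suc m))
      c = + 1 / suc m
      0≤c = 0≤1/[1+d] m

      ζ : Fin n → ℚ
      ζ _ = c

      sum-c : sumL ζ (allV n) ≡ fromℕ n * c
      sum-c = trans (sumL-const c (allV n)) (cong (λ k → fromℕ k * c) (length-allV n))

      total≡ : total ζ ≡ frac n (suc m)
      total≡ = trans sum-c (fromℕ-*-1/ n m)

      n*c≡1+2c : fromℕ n * c ≡ 1ℚ + (c + c)
      n*c≡1+2c = begin
        fromℕ n * c                       ≡⟨ fromℕ-suc-* c (suc (suc m)) ⟨
        c + fromℕ (suc (suc m)) * c       ≡⟨ cong (λ s → c + s) (fromℕ-suc-* c (suc m)) ⟨
        c + (c + fromℕ (suc m) * c)       ≡⟨ cong (λ s → c + (c + s)) (fromℕ-*-/ 1 m) ⟩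
        c + (c + 1ℚ)                      ≡⟨ solve 2 (λ x o → x :+ (x :+ o) := o :+ (x :+ x)) refl c 1ℚ ⟩
        1ℚ + (c + c)                      ∎
        where
          open ≡-Reasoning
          open ℚ-Solver.+-*-Solver

      edges : ∀ v w → adj G v w ≡ true → 1ℚ ≤ resSum G ζ v w
      edges v w v~w with exceptions v w (Equivalence.from T-≡ v~w)
      ... | X , Y , only = +-cancelʳ-≤ 1ℚ (resSum G ζ v w) (c + c) (begin
        1ℚ + (c + c)                                ≡⟨ n*c≡1+2c ⟨
        fromℕ n * c                                 ≡⟨ sum-c ⟨
        sumL ζ (allV n)                             ≤⟨ sumL-mono (allV n) (λ u → covered (resolves G u v w) 0≤c
                                                                           (only u ∘ resolves≡false⇒ G {u} {v} {w})) ⟩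
        sumL (λ u → r u + (IX u + IY u)) (allV n)   ≡⟨ sumL-+ r (λ u → IX u + IY u) (allV n) ⟩
        resSum G ζ v w + sumL (λ u → IX u + IY u) (allV n)
                                                    ≡⟨ cong (λ s → resSum G ζ v w + s) (sumL-+ IX IY (allV n)) ⟩
        resSum G ζ v w + (sumL IX (allV n) + sumL IY (allV n))
                                                    ≤⟨ +-monoʳ-≤ (resSum G ζ v w)
                                                         (+-mono-≤ (sumL-indicator-≤ n X 0≤c) (sumL-indicator-≤ n Y 0≤c)) ⟩
        resSum G ζ v w + (c + c)                    ∎)
        where
          open ≤-Reasoning
          r IX IY : Fin n → ℚ
          r u  = if resolves G u v w then c else 0ℚ
          IX u = if toℕ u ≡ᵇ X then c else 0ℚ
          IY u = if toℕ u ≡ᵇ Y then c else 0ℚ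

open import Data.Nat using (pred; _+_; _*_; _∸_; _⊓_; _≤_; _<_; ∣_-_∣; z≤n; s≤s)
open import Data.Nat.Properties

record IsDistanceProfile {n} (G : Graph n) (u : Fin n) (D : Fin n → ℕ) : Set where
  field
    source  : D u ≡ 0
    zero⇒≡  : ∀ v → D v ≡ 0 → u ≡ v
    step    : ∀ v w → T (adj G w v) → D v ≤ suc (D w)
    descent : ∀ v k → D v ≡ suc k → ∃[ w ] T (adj G w v) × D w ≤ k

module _ {n} {G : Graph n} {u : Fin n} {D : Fin n → ℕ} (profile : IsDistanceProfile G u D) where
  open IsDistanceProfile profile

  within⇒≤ : ∀ k v → T (within G k u v) → D v ≤ k
  within⇒≤ zero    v t = ≤-reflexive (trans (cong D (sym (toℕ-injective (≡ᵇ⇒≡ (toℕ u) (toℕ v) t)))) source)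
  within⇒≤ (suc k) v t with Equivalence.to T-∨ t
  ... | inj₁ t′ = m≤n⇒m≤1+n (within⇒≤ k v t′)
  ... | inj₂ t′ with satisfied (any⁻ _ (allV n) t′)
  ...   | w , t″ = ≤-trans (step v w (proj₂ uw-w)) (s≤s (within⇒≤ k w (proj₁ uw-w)))
    where uw-w = Equivalence.to T-∧ t″

  ≤⇒within : ∀ k v → D v ≤ k → T (within G k u v)
  ≤⇒within zero    v Dv≤0 rewrite zero⇒≡ v (n≤0⇒n≡0 Dv≤0) = ≡⇒≡ᵇ (toℕ v) (toℕ v) refl
  ≤⇒within (suc k) v Dv≤1+k with m≤n⇒m<n∨m≡n Dv≤1+k
  ... | inj₁ Dv≤k = Equivalence.from T-∨ (inj₁ (≤⇒within k v (≤-pred Dv≤k)))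
  ... | inj₂ Dv≡1+k with descent v k Dv≡1+k
  ...   | w , wv , Dw≤k = Equivalence.from T-∨ (inj₂ (any⁺ _ (lose (∈-allV w)
            (Equivalence.from T-∧ (≤⇒within k w Dw≤k , wv)))))

  searchDist≡ : ∀ k f v → k ≤ D v → D v ≤ k + f → searchDist G u v k f ≡ D v
  searchDist≡ k zero    v k≤Dv Dv≤k = ≤-antisym k≤Dv (subst (D v ≤_) (+-identityʳ k) Dv≤k)
  searchDist≡ k (suc f) v k≤Dv Dv≤k+f with within G k u v in eq
  ... | true  = ≤-antisym k≤Dv (within⇒≤ k v (subst T (sym eq) _))
  ... | false with m≤n⇒m<n∨m≡n k≤Dv
  ...   | inj₁ k<Dv = searchDist≡ (suc k) f v k<Dv (subst (D v ≤_) (+-suc k f) Dv≤k+f)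
  ...   | inj₂ k≡Dv = contradiction (≤⇒within k v (≤-reflexive (sym k≡Dv))) (subst T eq)

  dist≡ : ∀ v → D v ≤ n → dist G u v ≡ D v
  dist≡ v Dv≤n = searchDist≡ 0 n v z≤n Dv≤n

memℕ⇒∈ : ∀ {d} s → T (memℕ d s) → d ∈ s
memℕ⇒∈ {d} (x ∷ s) t with Equivalence.to T-∨ t
... | inj₁ d≡x = here (≡ᵇ⇒≡ d x d≡x)
... | inj₂ d∈s = there (memℕ⇒∈ s d∈s)

∈⇒memℕ : ∀ {d s} → d ∈ s → T (memℕ d s)
∈⇒memℕ {d} (here refl) = Equivalence.from T-∨ (inj₁ (≡⇒≡ᵇ d d refl))
∈⇒memℕ     (there d∈s) = Equivalence.from T-∨ (inj₂ (∈⇒memℕ d∈s))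

Toeplitz-adj⁻ : ∀ {n S} {v w : Fin n} → T (adj (Toeplitz n S) v w) → ∣ toℕ v - toℕ w ∣ ∈ S
Toeplitz-adj⁻ {S = S} t = memℕ⇒∈ S (proj₂ (Equivalence.to T-∧ t))

Toeplitz-adj⁺ : ∀ {n S} {v w : Fin n} → toℕ v ≢ toℕ w → ∣ toℕ v - toℕ w ∣ ∈ S → T (adj (Toeplitz n S) v w)
Toeplitz-adj⁺ v≢w d∈S = Equivalence.from T-∧ (subst (T ∘ not) (sym (≢⇒≡ᵇ≡false v≢w)) _ , ∈⇒memℕ d∈S)

∣m-n∣≡1⇒ : ∀ {m n} → ∣ m - n ∣ ≡ 1 → n ≡ suc m ⊎ m ≡ suc n
∣m-n∣≡1⇒ {zero}        {suc zero} _ = inj₁ refl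
∣m-n∣≡1⇒ {suc zero}    {zero}     _ = inj₂ refl
∣m-n∣≡1⇒ {suc m}       {suc n}    eq with ∣m-n∣≡1⇒ {m} {n} eq
... | inj₁ refl = inj₁ refl
... | inj₂ refl = inj₂ refl

∣n-1+n∣≡1 : ∀ n → ∣ n - suc n ∣ ≡ 1
∣n-1+n∣≡1 zero    = refl
∣n-1+n∣≡1 (suc n) = ∣n-1+n∣≡1 n

∣m+n-m∣≡n : ∀ m n → ∣ m + n - m ∣ ≡ n
∣m+n-m∣≡n m n = trans (∣-∣-comm (m + n) m) (∣m-m+n∣≡n m n)

∣m-1+n∣≡1+∣m-n∣ : ∀ {m n} → m ≤ n → ∣ m - suc n ∣ ≡ suc ∣ m - n ∣
∣m-1+n∣≡1+∣m-n∣ z≤n       = refl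
∣m-1+n∣≡1+∣m-n∣ (s≤s m≤n) = ∣m-1+n∣≡1+∣m-n∣ m≤n

∣m-n∣≡1+∣m-1+n∣ : ∀ {m n} → n < m → ∣ m - n ∣ ≡ suc ∣ m - suc n ∣
∣m-n∣≡1+∣m-1+n∣ {suc m} {zero}  (s≤s z≤n) = cong suc (sym (∣-∣-identityʳ m))
∣m-n∣≡1+∣m-1+n∣ {suc m} {suc n} (s≤s n<m) = ∣m-n∣≡1+∣m-1+n∣ n<m

∣m-1+n∣-step : ∀ m n → ∣ m - suc n ∣ ≡ suc ∣ m - n ∣ ⊎ ∣ m - n ∣ ≡ suc ∣ m - suc n ∣
∣m-1+n∣-step m n with m ≤? n
... | yes m≤n = inj₁ (∣m-1+n∣≡1+∣m-n∣ m≤n)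
... | no  m≰n = inj₂ (∣m-n∣≡1+∣m-1+n∣ (≰⇒> m≰n))

module Cycle (m1 : ℕ) where

  M : ℕ
  M = suc m1

  data CycleAdj : ℕ → ℕ → Set where
    step  : ∀ {y} → CycleAdj y (suc y)
    step⁻ : ∀ {y} → CycleAdj (suc y) y
    wrap  : CycleAdj 0 m1
    wrap⁻ : CycleAdj m1 0

  CycleAdj-sym : ∀ {y y′} → CycleAdj y y′ → CycleAdj y′ y
  CycleAdj-sym step  = step⁻
  CycleAdj-sym step⁻ = step
  CycleAdj-sym wrap  = wrap⁻
  CycleAdj-sym wrap⁻ = wrap

  -- the length of the shorter arc between two labels whose difference is d
  arc : ℕ → ℕ
  arc d = d ⊓ (M ∸ d)

  cdist : ℕ → ℕ → ℕ
  cdist x y = arc ∣ x - y ∣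

  arc≤ : ∀ d → arc d ≤ d
  arc≤ d = m⊓n≤m d (M ∸ d)

  arc≤M∸ : ∀ d → arc d ≤ M ∸ d
  arc≤M∸ d = m⊓n≤n d (M ∸ d)

  arc-sel : ∀ d → arc d ≡ d ⊎ arc d ≡ M ∸ d
  arc-sel d = ⊓-sel d (M ∸ d)

  arc-suc-≤ : ∀ d → arc (suc d) ≤ suc (arc d)
  arc-suc-≤ d = ⊓-mono-≤ ≤-refl (m≤n⇒m≤1+n (∸-monoʳ-≤ M (n≤1+n d)))

  arc-≤-suc : ∀ d → arc d ≤ suc (arc (suc d))
  arc-≤-suc d = ⊓-mono-≤ (m≤n⇒m≤1+n (n≤1+n d)) (m∸n≤1+m∸1+n M d)
    where
      m∸n≤1+m∸1+n : ∀ m n → m ∸ n ≤ suc (m ∸ suc n)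
      m∸n≤1+m∸1+n zero    n       = subst (_≤ 1) (sym (0∸n≡0 n)) z≤n
      m∸n≤1+m∸1+n (suc m) zero    = ≤-refl
      m∸n≤1+m∸1+n (suc m) (suc n) = m∸n≤1+m∸1+n m n

  arc-reflect : ∀ {d} → d ≤ M → arc (M ∸ d) ≡ arc d
  arc-reflect {d} d≤M rewrite m∸[m∸n]≡n d≤M = ⊓-comm (M ∸ d) d

  -- arc is strictly monotone up to M/2 and strictly antitone beyond, so it can only
  -- stall at the antipode of an odd cycle
  arc-flat : ∀ {d} → suc d ≤ M → arc d ≡ arc (suc d) → M ≡ suc (2 * d)
  arc-flat {d} 1+d≤M eq = trans (M≡1+d+d (arc-sel d) (arc-sel (suc d)))
                                (cong (λ e → suc (d + e)) (sym (+-identityʳ d)))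
    where
      open ≡-Reasoning
      M≡1+d+d : arc d ≡ d ⊎ arc d ≡ M ∸ d → arc (suc d) ≡ suc d ⊎ arc (suc d) ≡ M ∸ suc d →
                M ≡ suc (d + d)
      M≡1+d+d (inj₁ a) (inj₁ b) = contradiction (trans (sym b) (trans (sym eq) a)) 1+n≢n
      M≡1+d+d (inj₁ a) (inj₂ b) = begin
        M                   ≡⟨ m∸n+n≡m 1+d≤M ⟨
        (M ∸ suc d) + suc d ≡⟨ cong (_+ suc d) (trans (sym b) (trans (sym eq) a)) ⟩
        d + suc d           ≡⟨ +-suc d d ⟩
        suc (d + d)         ∎
      M≡1+d+d (inj₂ a) (inj₁ b) = begin
        M             ≡⟨ m∸n+n≡m (≤-trans (n≤1+n d) 1+d≤M) ⟨
        (M ∸ d) + d   ≡⟨ cong (_+ d) (trans (sym a) (trans eq b)) ⟩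
        suc d + d     ∎
      M≡1+d+d (inj₂ a) (inj₂ b) =
        contradiction (trans (sym (+-∸-assoc 1 (≤-pred 1+d≤M))) (trans (sym a) (trans eq b))) 1+n≢n

  cdist-self : ∀ x → cdist x x ≡ 0
  cdist-self x = cong arc (∣n-n∣≡0 x)

  cdist-sym : ∀ x y → cdist x y ≡ cdist y x
  cdist-sym x y = cong arc (∣-∣-comm x y)

  ∣-∣<M : ∀ {x y} → x < M → y < M → ∣ x - y ∣ < M
  ∣-∣<M {x} {y} x<M y<M = ≤-<-trans (∣m-n∣≤m⊔n x y) (⊔-lub x<M y<M)

  cdist<M : ∀ {x y} → x < M → y < M → cdist x y < M
  cdist<M x<M y<M = ≤-<-trans (arc≤ _) (∣-∣<M x<M y<M)

  cdist≡0⇒≡ : ∀ {x y} → x < M → y < M → cdist x y ≡ 0 → x ≡ y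
  cdist≡0⇒≡ {x} {y} x<M y<M eq with arc-sel ∣ x - y ∣
  ... | inj₁ a = ∣m-n∣≡0⇒m≡n (trans (sym a) eq)
  ... | inj₂ a = contradiction (m∸n≡0⇒m≤n (trans (sym a) eq)) (<⇒≱ (∣-∣<M x<M y<M))

  cdist-m1 : ∀ {x} → x ≤ m1 → cdist x m1 ≡ arc (m1 ∸ x)
  cdist-m1 x≤m1 = cong arc (m≤n⇒∣m-n∣≡n∸m x≤m1)

  -- measured the other way round, across the edge {m1, 0}
  cdist-0 : ∀ {x} → x ≤ m1 → cdist x 0 ≡ arc (suc (m1 ∸ x))
  cdist-0 {x} x≤m1 = begin
    arc ∣ x - 0 ∣      ≡⟨ cong arc (∣-∣-identityʳ x) ⟩
    arc x              ≡⟨ arc-reflect (m≤n⇒m≤1+n x≤m1) ⟨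
    arc (M ∸ x)        ≡⟨ cong arc (+-∸-assoc 1 x≤m1) ⟩
    arc (suc (m1 ∸ x)) ∎
    where open ≡-Reasoning

  cdist-step : ∀ {x y y′} → x < M → CycleAdj y y′ → cdist x y′ ≤ suc (cdist x y)
  cdist-step {x} {y} _ step with ∣m-1+n∣-step x y
  ... | inj₁ eq rewrite eq = arc-suc-≤ _
  ... | inj₂ eq rewrite eq = arc-≤-suc _
  cdist-step {x} {_} {y′} _ step⁻ with ∣m-1+n∣-step x y′
  ... | inj₁ eq rewrite eq = arc-≤-suc _
  ... | inj₂ eq rewrite eq = arc-suc-≤ _
  cdist-step (s≤s x≤m1) wrap  rewrite cdist-0 x≤m1 | cdist-m1 x≤m1 = arc-≤-suc _
  cdist-step (s≤s x≤m1) wrap⁻ rewrite cdist-0 x≤m1 | cdist-m1 x≤m1 = arc-suc-≤ _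

  step-toward : ∀ {x y} → x < M → y < M → x ≢ y →
                ∃[ y′ ] y′ < M × CycleAdj y′ y × suc ∣ x - y′ ∣ ≡ ∣ x - y ∣
  step-toward {x} {y} x<M y<M x≢y with <-cmp x y
  step-toward {x} {suc y₀} _ y<M _ | tri< x<y _ _ =
    y₀ , <-trans (n<1+n y₀) y<M , step , sym (∣m-1+n∣≡1+∣m-n∣ (≤-pred x<y))
  ... | tri≈ _ x≡y _ = contradiction x≡y x≢y
  ... | tri> _ _ y<x = suc y , ≤-<-trans y<x x<M , step⁻ , sym (∣m-n∣≡1+∣m-1+n∣ y<x)

  step-away : ∀ {x y} → x < M → y < M →
              ∃[ y′ ] y′ < M × CycleAdj y′ y × cdist x y′ ≤ M ∸ suc ∣ x - y ∣
  step-away {x} {y} x<M y<M with x ≤? y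
  ... | yes x≤y with m≤n⇒m<n∨m≡n y<M
  ...   | inj₁ 1+y<M = suc y , 1+y<M , step⁻ ,
          ≤-trans (≤-reflexive (cong arc (∣m-1+n∣≡1+∣m-n∣ x≤y))) (arc≤M∸ _)
  ...   | inj₂ refl = 0 , s≤s z≤n , wrap ,
          subst₂ _≤_ (cong arc (sym (∣-∣-identityʳ x)))
                     (trans (sym (m∸[m∸n]≡n x≤y)) (cong (λ d → M ∸ suc d) (sym (m≤n⇒∣m-n∣≡n∸m x≤y))))
                     (arc≤ x)
  step-away {zero}  {zero} _ _ | no 0≰0 = contradiction z≤n 0≰0
  step-away {suc x} {zero} (s≤s 1+x≤m1) _ | no _ = m1 , ≤-refl , wrap⁻ ,
    ≤-trans (≤-reflexive (cdist-m1 1+x≤m1)) (arc≤ _)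
  step-away {x} {suc y₀} _ y<M | no x≰y = y₀ , <-trans (n<1+n y₀) y<M , step ,
    ≤-trans (≤-reflexive (cong arc (∣m-n∣≡1+∣m-1+n∣ (<-trans (n<1+n y₀) (≰⇒> x≰y))))) (arc≤M∸ _)

  -- a shortest path to y arrives along the shorter arc: step back toward x if that arc
  -- is the direct one, and away from x if it wraps around
  cdist-descent : ∀ {x y k} → x < M → y < M → cdist x y ≡ suc k →
                  ∃[ y′ ] y′ < M × CycleAdj y′ y × cdist x y′ ≤ k
  cdist-descent {x} {y} {k} x<M y<M eq with arc-sel ∣ x - y ∣
  ... | inj₁ direct with step-toward x<M y<M (λ { refl → 0≢1+n (trans (sym (cdist-self x)) eq) })
  ...   | y′ , y′<M , adj , shorter = y′ , y′<M , adj ,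
          ≤-trans (arc≤ _) (≤-reflexive (suc-injective (trans shorter (trans (sym direct) eq))))
  cdist-descent {x} {y} {k} x<M y<M eq | inj₂ around with step-away x<M y<M
  ... | y′ , y′<M , adj , bound = y′ , y′<M , adj , ≤-trans bound (≤-reflexive (begin
    M ∸ suc ∣ x - y ∣       ≡⟨ pred[m∸n]≡m∸[1+n] M ∣ x - y ∣ ⟨
    pred (M ∸ ∣ x - y ∣)    ≡⟨ cong pred (trans (sym around) eq) ⟩
    k                       ∎))
    where open ≡-Reasoning

  cdist-to-0 : ∀ {x} → 0 < x → x < M → cdist x 0 ≡ suc (cdist x 1 ⊓ cdist x m1)
  cdist-to-0 {x} 0<x x<M with cdist x 0 in eq
  ... | zero = contradiction (cdist≡0⇒≡ x<M (s≤s z≤n) eq) (≢-sym (<⇒≢ 0<x))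
  ... | suc k = ≤-antisym
    (⊓-glb (subst (_≤ suc (cdist x 1)) eq (cdist-step x<M step⁻))
           (subst (_≤ suc (cdist x m1)) eq (cdist-step x<M wrap⁻)))
    (s≤s (from-neighbour (cdist-descent x<M (s≤s z≤n) eq)))
    where
      from-neighbour : ∃[ y′ ] y′ < M × CycleAdj y′ 0 × cdist x y′ ≤ k → cdist x 1 ⊓ cdist x m1 ≤ k
      from-neighbour (_ , _ , step⁻ , le) = ≤-trans (m⊓n≤m _ _) le
      from-neighbour (_ , _ , wrap⁻ , le) = ≤-trans (m⊓n≤n _ _) le
      -- possible only when m1 = 0
      from-neighbour (_ , _ , wrap  , le) = ≤-trans (m⊓n≤n _ _) le

-- T_p⟨1, p - 2⟩ for p = q + 3, on the labels toℕ v ∈ {0, …, M} with M = q + 2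
module Apex (q : ℕ) where

  m1 : ℕ
  m1 = suc q

  open Cycle m1 public

  data Adj : ℕ → ℕ → Set where
    cycle : ∀ {a b} → CycleAdj a b → Adj a b
    apex  : Adj 1 M
    apex⁻ : Adj M 1

  Adj-sym : ∀ {a b} → Adj a b → Adj b a
  Adj-sym (cycle c) = cycle (CycleAdj-sym c)
  Adj-sym apex      = apex⁻
  Adj-sym apex⁻     = apex

  data Position : ℕ → Set where
    onCycle : ∀ {a} → a < M → Position a
    atApex  : Position M

  position : ∀ {a} → a ≤ M → Position a
  position a≤M with m≤n⇒m<n∨m≡n a≤M
  ... | inj₁ a<M = onCycle a<M
  ... | inj₂ refl = atApex

  Adj⇒CycleAdj : ∀ {b b′} → b < M → b′ < M → Adj b b′ → CycleAdj b b′
  Adj⇒CycleAdj _   _    (cycle c) = c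
  Adj⇒CycleAdj _   b′<M apex      = contradiction b′<M (<-irrefl refl)
  Adj⇒CycleAdj b<M _    apex⁻     = contradiction b<M (<-irrefl refl)

  -- the apex is a twin of 0: both have exactly the neighbours 1 and m1
  apex-neighbour : ∀ {b} → b < M → Adj b M → CycleAdj b 0
  apex-neighbour _   (cycle step)  = wrap⁻
  apex-neighbour b<M (cycle step⁻) = contradiction (<-trans (n<1+n M) b<M) (<-irrefl refl)
  apex-neighbour _   apex          = step⁻

  twin-neighbour : ∀ {b} → CycleAdj b 0 → Adj b M
  twin-neighbour step⁻ = apex
  twin-neighbour wrap⁻ = cycle step

  ¬Adj-apex-apex : ¬ Adj M M
  ¬Adj-apex-apex (cycle ())

  -- dist′ a b is the distance between the labels a and b; the apex is reached through
  -- the nearer of its two neighbours 1 and m1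
  toApex : ℕ → ℕ
  toApex a = suc (cdist a 1 ⊓ cdist a m1)

  fromApex : ℕ → ℕ
  fromApex b = suc (cdist 1 b ⊓ cdist m1 b)

  dist′ : ℕ → ℕ → ℕ
  dist′ a b with a ≡ᵇ M | b ≡ᵇ M
  ... | false | false = cdist a b
  ... | false | true  = toApex a
  ... | true  | false = fromApex b
  ... | true  | true  = 0

  dist′-cycle : ∀ {a b} → a < M → b < M → dist′ a b ≡ cdist a b
  dist′-cycle a<M b<M rewrite ≢⇒≡ᵇ≡false (<⇒≢ a<M) | ≢⇒≡ᵇ≡false (<⇒≢ b<M) = refl

  dist′-toApex : ∀ {a} → a < M → dist′ a M ≡ toApex a
  dist′-toApex a<M rewrite ≢⇒≡ᵇ≡false (<⇒≢ a<M) | ≡ᵇ-refl M = refl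

  dist′-fromApex : ∀ {b} → b < M → dist′ M b ≡ fromApex b
  dist′-fromApex b<M rewrite ≢⇒≡ᵇ≡false (<⇒≢ b<M) | ≡ᵇ-refl M = refl

  dist′-apex : dist′ M M ≡ 0
  dist′-apex rewrite ≡ᵇ-refl M = refl

  toApex-≤ : ∀ a {s} → CycleAdj s 0 → toApex a ≤ suc (cdist a s)
  toApex-≤ a step⁻ = s≤s (m⊓n≤m _ _)
  toApex-≤ a wrap⁻ = s≤s (m⊓n≤n _ _)

  toApex-attained : ∀ a → ∃[ s ] CycleAdj s 0 × toApex a ≡ suc (cdist a s)
  toApex-attained a with ⊓-sel (cdist a 1) (cdist a m1)
  ... | inj₁ eq = 1 , step⁻ , cong suc eq
  ... | inj₂ eq = m1 , wrap⁻ , cong suc eq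

  fromApex-≤ : ∀ b {s} → CycleAdj s 0 → fromApex b ≤ suc (cdist s b)
  fromApex-≤ b step⁻ = s≤s (m⊓n≤m _ _)
  fromApex-≤ b wrap⁻ = s≤s (m⊓n≤n _ _)

  fromApex-attained : ∀ b → ∃[ s ] CycleAdj s 0 × fromApex b ≡ suc (cdist s b)
  fromApex-attained b with ⊓-sel (cdist 1 b) (cdist m1 b)
  ... | inj₁ eq = 1 , step⁻ , cong suc eq
  ... | inj₂ eq = m1 , wrap⁻ , cong suc eq

  neighbour-of-0<M : ∀ {s} → CycleAdj s 0 → s < M
  neighbour-of-0<M step⁻ = s≤s (s≤s z≤n)
  neighbour-of-0<M wrap⁻ = ≤-refl

  cdist-via-0 : ∀ {a s s′} → a < M → CycleAdj s 0 → CycleAdj 0 s′ → cdist a s′ ≤ suc (suc (cdist a s))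
  cdist-via-0 a<M s~0 0~s′ = ≤-trans (cdist-step a<M 0~s′) (s≤s (cdist-step a<M s~0))

  dist′-self : ∀ {a} → a ≤ M → dist′ a a ≡ 0
  dist′-self {a} a≤M with position a≤M
  ... | onCycle a<M = trans (dist′-cycle a<M a<M) (cdist-self a)
  ... | atApex      = dist′-apex

  dist′≡0⇒≡ : ∀ {a b} → a ≤ M → b ≤ M → dist′ a b ≡ 0 → a ≡ b
  dist′≡0⇒≡ a≤M b≤M eq with position a≤M | position b≤M
  ... | onCycle a<M | onCycle b<M = cdist≡0⇒≡ a<M b<M (trans (sym (dist′-cycle a<M b<M)) eq)
  ... | onCycle a<M | atApex      = contradiction (trans (sym (dist′-toApex a<M)) eq) 1+n≢0
  ... | atApex      | onCycle b<M = contradiction (trans (sym (dist′-fromApex b<M)) eq) 1+n≢0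
  ... | atApex      | atApex      = refl

  dist′≤M : ∀ {a b} → a ≤ M → b ≤ M → dist′ a b ≤ M
  dist′≤M a≤M b≤M with position a≤M | position b≤M
  ... | onCycle a<M | onCycle b<M = ≤-trans (≤-reflexive (dist′-cycle a<M b<M)) (<⇒≤ (cdist<M a<M b<M))
  ... | onCycle {a} a<M | atApex  = ≤-trans (≤-reflexive (dist′-toApex a<M))
                                       (≤-trans (toApex-≤ a step⁻) (cdist<M a<M (s≤s (s≤s z≤n))))
  ... | atApex  | onCycle {b} b<M = ≤-trans (≤-reflexive (dist′-fromApex b<M))
                                       (≤-trans (fromApex-≤ b step⁻) (cdist<M (s≤s (s≤s z≤n)) b<M))
  ... | atApex      | atApex      = ≤-trans (≤-reflexive dist′-apex) z≤n

  dist′-step : ∀ {a b b′} → a ≤ M → b ≤ M → b′ ≤ M → Adj b b′ → dist′ a b′ ≤ suc (dist′ a b)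
  dist′-step a≤M b≤M b′≤M adj with position a≤M | position b≤M | position b′≤M
  ... | onCycle a<M | onCycle b<M | onCycle b′<M
    rewrite dist′-cycle a<M b<M | dist′-cycle a<M b′<M = cdist-step a<M (Adj⇒CycleAdj b<M b′<M adj)
  ... | onCycle {a} a<M | onCycle b<M | atApex
    rewrite dist′-cycle a<M b<M | dist′-toApex a<M = toApex-≤ a (apex-neighbour b<M adj)
  ... | onCycle _ | atApex | atApex = contradiction adj ¬Adj-apex-apex
  ... | atApex | onCycle b<M | onCycle b′<M
    rewrite dist′-fromApex b<M | dist′-fromApex b′<M =
      s≤s (⊓-mono-≤ (cdist-step (s≤s (s≤s z≤n)) c) (cdist-step ≤-refl c))
    where c = Adj⇒CycleAdj b<M b′<M adj
  ... | atApex | onCycle b<M | atApex rewrite dist′-apex = z≤n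
  ... | atApex | atApex | onCycle {b′} b′<M rewrite dist′-apex | dist′-fromApex b′<M =
    ≤-trans (fromApex-≤ b′ (apex-neighbour b′<M (Adj-sym adj))) (≤-reflexive (cong suc (cdist-self b′)))
  ... | atApex | atApex | atApex = contradiction adj ¬Adj-apex-apex
  ... | onCycle {a} a<M | atApex | onCycle b′<M
    rewrite dist′-toApex a<M | dist′-cycle a<M b′<M with toApex-attained a
  ...   | s , s~0 , eq rewrite eq =
          cdist-via-0 a<M s~0 (CycleAdj-sym (apex-neighbour b′<M (Adj-sym adj)))

  dist′-descent : ∀ {a b k} → a ≤ M → b ≤ M → dist′ a b ≡ suc k →
                  ∃[ b′ ] b′ ≤ M × Adj b′ b × dist′ a b′ ≤ k
  dist′-descent {a} {b} {k} a≤M b≤M eq with position a≤M | position b≤M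
  ... | atApex | atApex = contradiction (trans (sym dist′-apex) eq) 0≢1+n
  ... | onCycle a<M | onCycle b<M
    with cdist-descent a<M b<M (trans (sym (dist′-cycle a<M b<M)) eq)
  ...   | y′ , y′<M , y′~b , le = y′ , <⇒≤ y′<M , cycle y′~b , ≤-trans (≤-reflexive (dist′-cycle a<M y′<M)) le
  dist′-descent {a} {_} {k} _ _ eq | onCycle a<M | atApex with toApex-attained a
  ... | s , s~0 , attained = s , <⇒≤ s<M , twin-neighbour s~0 ,
        ≤-reflexive (trans (dist′-cycle a<M s<M) (suc-injective (trans (sym attained) (trans (sym (dist′-toApex a<M)) eq))))
    where s<M = neighbour-of-0<M s~0
  dist′-descent {_} {b} {k} _ _ eq | atApex | onCycle b<M with fromApex-attained b
  ... | s , s~0 , attained = via s~0 (suc-injective (trans (sym attained) (trans (sym (dist′-fromApex b<M)) eq)))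
    where
      via : ∀ {s k} → CycleAdj s 0 → cdist s b ≡ k → ∃[ b′ ] b′ ≤ M × Adj b′ b × dist′ M b′ ≤ k
      via {s} {zero} s~0 eq with cdist≡0⇒≡ (neighbour-of-0<M s~0) b<M eq
      ... | refl = M , ≤-refl , Adj-sym (twin-neighbour s~0) , ≤-reflexive dist′-apex
      via {s} {suc k} s~0 eq with cdist-descent (neighbour-of-0<M s~0) b<M eq
      ... | y′ , y′<M , y′~b , le = y′ , <⇒≤ y′<M , cycle y′~b ,
            ≤-trans (≤-reflexive (dist′-fromApex y′<M)) (≤-trans (fromApex-≤ y′ s~0) (s≤s le))

  arc-m1 : arc m1 ≡ 1
  arc-m1 rewrite m+n∸n≡m 1 q | ⊓-zeroʳ q = refl

  cdist-0-neighbour : ∀ {s} → CycleAdj s 0 → cdist 0 s ≡ 1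
  cdist-0-neighbour step⁻ = refl
  cdist-0-neighbour wrap⁻ = arc-m1

  dist′-0-apex : dist′ 0 M ≡ 2
  dist′-0-apex = trans (dist′-toApex (s≤s z≤n)) (cong (λ d → suc (1 ⊓ d)) arc-m1)

  dist′-twinʳ : ∀ {a} → 0 < a → a < M → dist′ a M ≡ cdist a 0
  dist′-twinʳ 0<a a<M = trans (dist′-toApex a<M) (sym (cdist-to-0 0<a a<M))

  dist′-twinˡ : ∀ {b} → 0 < b → b < M → dist′ M b ≡ cdist 0 b
  dist′-twinˡ {b} 0<b b<M = begin
    dist′ M b                       ≡⟨ dist′-fromApex b<M ⟩
    suc (cdist 1 b ⊓ cdist m1 b)    ≡⟨ cong₂ (λ x y → suc (x ⊓ y)) (cdist-sym 1 b) (cdist-sym m1 b) ⟩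
    suc (cdist b 1 ⊓ cdist b m1)    ≡⟨ cdist-to-0 0<b b<M ⟨
    cdist b 0                       ≡⟨ cdist-sym b 0 ⟩
    cdist 0 b                       ∎
    where open ≡-Reasoning

  Steps : List ℕ
  Steps = 1 ∷ m1 ∷ []

  long-jump : ∀ {a b} → b ≤ M → b ∸ a ≡ m1 → Adj a b
  long-jump {zero}        _   refl = cycle wrap
  long-jump {suc zero} {suc b} _ refl = apex
  long-jump {suc (suc a)} {b} b≤M eq =
    contradiction (≤-trans (≤-reflexive (sym eq)) (≤-trans (∸-monoˡ-≤ (suc (suc a)) b≤M) (m∸n≤m q a))) 1+n≰n

  ∈Steps⇒Adj : ∀ {a b} → a ≤ M → b ≤ M → ∣ a - b ∣ ∈ Steps → Adj a b
  ∈Steps⇒Adj {a} {b} _ _ (here eq) with ∣m-n∣≡1⇒ {a} {b} eq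
  ... | inj₁ refl = cycle step
  ... | inj₂ refl = cycle step⁻
  ∈Steps⇒Adj {a} {b} a≤M b≤M (there (here eq)) with ∣m-n∣≡[m∸n]∨[n∸m] a b
  ... | inj₁ eq′ = Adj-sym (long-jump a≤M (trans (sym eq′) eq))
  ... | inj₂ eq′ = long-jump b≤M (trans (sym eq′) eq)

  Adj⇒∈Steps : ∀ {a b} → Adj a b → ∣ a - b ∣ ∈ Steps
  Adj⇒∈Steps (cycle (step {y}))  = here (∣n-1+n∣≡1 y)
  Adj⇒∈Steps (cycle (step⁻ {y})) = here (trans (∣-∣-comm (suc y) y) (∣n-1+n∣≡1 y))
  Adj⇒∈Steps (cycle wrap)        = there (here refl)
  Adj⇒∈Steps (cycle wrap⁻)       = there (here refl)
  Adj⇒∈Steps apex                = there (here refl)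
  Adj⇒∈Steps apex⁻               = there (here refl)

  Adj⇒≢ : ∀ {a b} → Adj a b → a ≢ b
  Adj⇒≢ {a} adj refl with subst (_∈ Steps) (∣n-n∣≡0 a) (Adj⇒∈Steps adj)
  ... | there (here ())

  p : ℕ
  p = suc M

  G : Graph p
  G = Toeplitz p Steps

  label≤M : (v : Fin p) → toℕ v ≤ M
  label≤M v = ≤-pred (toℕ<n v)

  vertex : ∀ {b} → b ≤ M → ∃[ v ] toℕ v ≡ b
  vertex b≤M = fromℕ< (s≤s b≤M) , toℕ-fromℕ< (s≤s b≤M)

  adj⇒Adj : ∀ {v w} → T (adj G v w) → Adj (toℕ v) (toℕ w)
  adj⇒Adj {v} {w} t = ∈Steps⇒Adj (label≤M v) (label≤M w) (Toeplitz-adj⁻ {v = v} {w} t)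

  Adj⇒adj : ∀ {v w} → Adj (toℕ v) (toℕ w) → T (adj G v w)
  Adj⇒adj a = Toeplitz-adj⁺ (Adj⇒≢ a) (Adj⇒∈Steps a)

  dist≡dist′ : ∀ u v → dist G u v ≡ dist′ (toℕ u) (toℕ v)
  dist≡dist′ u v = dist≡ profile v (m≤n⇒m≤1+n (dist′≤M (label≤M u) (label≤M v)))
    where
      descent : ∀ v k → dist′ (toℕ u) (toℕ v) ≡ suc k → ∃[ w ] T (adj G w v) × dist′ (toℕ u) (toℕ w) ≤ k
      descent v k eq with dist′-descent (label≤M u) (label≤M v) eq
      ... | b′ , b′≤M , b′~v , le with vertex b′≤M
      ...   | w , refl = w , Adj⇒adj b′~v , le

      profile : IsDistanceProfile G u (dist′ (toℕ u) ∘ toℕ)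
      profile = record
        { source  = dist′-self (label≤M u)
        ; zero⇒≡  = λ v eq → toℕ-injective (dist′≡0⇒≡ (label≤M u) (label≤M v) eq)
        ; step    = λ v w t → dist′-step (label≤M u) (label≤M w) (label≤M v) (adj⇒Adj t)
        ; descent = descent
        }

  apex-edge-resolved : ∀ {s} → CycleAdj s 0 → dist′ 0 s ≢ dist′ 0 M
  apex-edge-resolved {s} s~0 eq = contradiction (begin
    1            ≡⟨ cdist-0-neighbour s~0 ⟨
    cdist 0 s    ≡⟨ dist′-cycle (s≤s z≤n) (neighbour-of-0<M s~0) ⟨
    dist′ 0 s    ≡⟨ eq ⟩
    dist′ 0 M    ≡⟨ dist′-0-apex ⟩
    2            ∎) (λ ())
    where open ≡-Reasoning

  module EvenCycle {k} (M≡2k : M ≡ 2 * k) where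

    cycle-edge-resolved : ∀ {b b′} → b < M → b′ < M → CycleAdj b b′ → cdist 0 b ≢ cdist 0 b′
    cycle-edge-resolved _ b′<M (step {b}) eq = even≢odd k b (trans (sym M≡2k) (arc-flat (<⇒≤ b′<M) eq))
    cycle-edge-resolved _ _ wrap  eq = 0≢1+n (trans eq arc-m1)
    cycle-edge-resolved b<M b′<M c@step⁻ eq = cycle-edge-resolved b′<M b<M (CycleAdj-sym c) (sym eq)
    cycle-edge-resolved b<M b′<M c@wrap⁻ eq = cycle-edge-resolved b′<M b<M (CycleAdj-sym c) (sym eq)

    0-resolves′ : ∀ {b b′} → b ≤ M → b′ ≤ M → Adj b b′ → dist′ 0 b ≢ dist′ 0 b′
    0-resolves′ b≤M b′≤M adj with position b≤M | position b′≤M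
    ... | onCycle b<M | onCycle b′<M rewrite dist′-cycle (s≤s z≤n) b<M | dist′-cycle (s≤s z≤n) b′<M =
      cycle-edge-resolved b<M b′<M (Adj⇒CycleAdj b<M b′<M adj)
    ... | onCycle b<M | atApex       = apex-edge-resolved (apex-neighbour b<M adj)
    ... | atApex      | onCycle b′<M = apex-edge-resolved (apex-neighbour b′<M (Adj-sym adj)) ∘ sym
    ... | atApex      | atApex       = contradiction adj ¬Adj-apex-apex

    0-resolves : ∀ v w → T (adj G v w) → dist G Fin.zero v ≢ dist G Fin.zero w
    0-resolves v w v~w rewrite dist≡dist′ Fin.zero v | dist≡dist′ Fin.zero w =
      0-resolves′ (label≤M v) (label≤M w) (adj⇒Adj v~w)

  module OddCycle {j} (M≡1+2j : M ≡ suc (2 * j)) where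

    m1≡j+j : m1 ≡ j + j
    m1≡j+j = trans (suc-injective M≡1+2j) (cong (j +_) (+-identityʳ j))

    m1∸j≡j : m1 ∸ j ≡ j
    m1∸j≡j = trans (cong (_∸ j) m1≡j+j) (m+n∸n≡m j j)

    j≤m1 : j ≤ m1
    j≤m1 = subst (j ≤_) (sym m1≡j+j) (m≤m+n j j)

    arc-j : arc j ≡ j
    arc-j = trans (cong (j ⊓_) (trans (+-∸-assoc 1 j≤m1) (cong suc m1∸j≡j))) (m≤n⇒m⊓n≡m (n≤1+n j))

    arc-1+j : arc (suc j) ≡ j
    arc-1+j = trans (cong (suc j ⊓_) m1∸j≡j) (m≥n⇒m⊓n≡n (n≤1+n j))

    flat-at-j : ∀ {d} → suc d ≤ M → arc d ≡ arc (suc d) → d ≡ j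
    flat-at-j 1+d≤M eq = *-cancelˡ-≡ _ _ 2 (suc-injective (trans (sym (arc-flat 1+d≤M eq)) M≡1+2j))

    equidistant-step : ∀ {a c} → a < M → suc c < M → cdist a c ≡ cdist a (suc c) →
                       c ≡ a + j ⊎ a ≡ suc (c + j)
    equidistant-step {a} {c} a<M 1+c<M eq with a ≤? c
    ... | yes a≤c = inj₁ (begin
      c             ≡⟨ m+[n∸m]≡n a≤c ⟨
      a + (c ∸ a)   ≡⟨ cong (a +_) (trans (sym (m≤n⇒∣m-n∣≡n∸m a≤c)) (flat-at-j 1+d≤M flat)) ⟩
      a + j         ∎)
      where
        open ≡-Reasoning
        1+d≤M = <⇒≤ (subst (_< M) (∣m-1+n∣≡1+∣m-n∣ a≤c) (∣-∣<M a<M 1+c<M))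
        flat = trans eq (cong arc (∣m-1+n∣≡1+∣m-n∣ a≤c))
    ... | no a≰c = inj₂ (begin
      a                   ≡⟨ m+[n∸m]≡n c<a ⟨
      suc c + (a ∸ suc c) ≡⟨ cong (suc c +_) (trans (sym (m≤n⇒∣n-m∣≡n∸m c<a)) (flat-at-j 1+d≤M flat)) ⟩
      suc (c + j)         ∎)
      where
        open ≡-Reasoning
        c<a = ≰⇒> a≰c
        1+d≤M = <⇒≤ (subst (_< M) (∣m-n∣≡1+∣m-1+n∣ c<a) (∣-∣<M a<M (<-trans (n<1+n c) 1+c<M)))
        flat = sym (trans (sym (cong arc (∣m-n∣≡1+∣m-1+n∣ c<a))) eq)

    Antipode : ℕ → ℕ → Set
    Antipode b b′ = ∃[ X ] ∀ {a} → a < M → cdist a b ≡ cdist a b′ → a ≡ X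

    antipode-step : ∀ {c} → suc c < M → Antipode c (suc c)
    antipode-step {c} 1+c<M with j ≤? c
    ... | yes j≤c = c ∸ j , λ {a} a<M eq → case equidistant-step a<M 1+c<M eq of λ where
      (inj₁ c≡a+j)   → sym (trans (cong (_∸ j) c≡a+j) (m+n∸n≡m a j))
      (inj₂ a≡1+c+j) → contradiction (subst (_< M) a≡1+c+j a<M) (≤⇒≯ (s≤s (subst (_≤ c + j) (sym m1≡j+j) (+-monoˡ-≤ j j≤c))))
    ... | no j≰c = suc (c + j) , λ {a} a<M eq → case equidistant-step a<M 1+c<M eq of λ where
      (inj₁ c≡a+j)   → contradiction (subst (j ≤_) (sym c≡a+j) (m≤n+m j a)) j≰c
      (inj₂ a≡1+c+j) → a≡1+c+j

    antipode-wrap : Antipode 0 m1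
    antipode-wrap = j , λ {a} a<M eq → begin
      a                ≡⟨ m∸[m∸n]≡n (≤-pred a<M) ⟨
      m1 ∸ (m1 ∸ a)    ≡⟨ cong (m1 ∸_) (flat-at-j (s≤s (m∸n≤m m1 a))
                            (sym (trans (sym (cdist-0 (≤-pred a<M))) (trans eq (cdist-m1 (≤-pred a<M)))))) ⟩
      m1 ∸ j           ≡⟨ m1∸j≡j ⟩
      j                ∎
      where open ≡-Reasoning

    antipode-sym : ∀ {b b′} → Antipode b b′ → Antipode b′ b
    antipode-sym (X , spec) = X , λ a<M eq → spec a<M (sym eq)

    antipode : ∀ {b b′} → b < M → b′ < M → CycleAdj b b′ → Antipode b b′
    antipode _   b′<M step  = antipode-step b′<M
    antipode b<M _    step⁻ = antipode-sym (antipode-step b<M)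
    antipode _   _    wrap  = antipode-wrap
    antipode _   _    wrap⁻ = antipode-sym antipode-wrap

    Exceptions : ℕ → ℕ → Set
    Exceptions b b′ = ∃[ X ] ∀ {a} → a ≤ M → dist′ a b ≡ dist′ a b′ → a ≡ X ⊎ a ≡ M

    exceptions-sym : ∀ {b b′} → Exceptions b b′ → Exceptions b′ b
    exceptions-sym (X , spec) = X , λ a≤M eq → spec a≤M (sym eq)

    cycle-edge-exceptions : ∀ {b b′} → b < M → b′ < M → CycleAdj b b′ → Exceptions b b′
    cycle-edge-exceptions {b} {b′} b<M b′<M c with antipode b<M b′<M c
    ... | X , spec = X , λ a≤M eq → except a≤M eq
      where
        except : ∀ {a} → a ≤ M → dist′ a b ≡ dist′ a b′ → a ≡ X ⊎ a ≡ M
        except a≤M eq with position a≤M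
        ... | onCycle a<M = inj₁ (spec a<M (trans (sym (dist′-cycle a<M b<M)) (trans eq (dist′-cycle a<M b′<M))))
        ... | atApex      = inj₂ refl

    -- the apex being a twin of 0, the edge {s, M} is left unresolved by the same vertex as {s, 0}
    apex-edge-exceptions : ∀ {s} → CycleAdj s 0 → Exceptions s M
    apex-edge-exceptions {s} s~0 with antipode (neighbour-of-0<M s~0) (s≤s z≤n) s~0
    ... | X , spec = X , λ a≤M eq → except a≤M eq
      where
        s<M = neighbour-of-0<M s~0
        except : ∀ {a} → a ≤ M → dist′ a s ≡ dist′ a M → a ≡ X ⊎ a ≡ M
        except a≤M eq with position a≤M
        ... | atApex = inj₂ refl
        ... | onCycle {zero} _ = contradiction eq (apex-edge-resolved s~0)
        ... | onCycle {suc a} a<M =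
          inj₁ (spec a<M (trans (sym (dist′-cycle a<M s<M)) (trans eq (dist′-twinʳ (s≤s z≤n) a<M))))

    edge-exceptions′ : ∀ {b b′} → b ≤ M → b′ ≤ M → Adj b b′ → Exceptions b b′
    edge-exceptions′ b≤M b′≤M adj with position b≤M | position b′≤M
    ... | onCycle b<M | onCycle b′<M = cycle-edge-exceptions b<M b′<M (Adj⇒CycleAdj b<M b′<M adj)
    ... | onCycle b<M | atApex       = apex-edge-exceptions (apex-neighbour b<M adj)
    ... | atApex      | onCycle b′<M = exceptions-sym (apex-edge-exceptions (apex-neighbour b′<M (Adj-sym adj)))
    ... | atApex      | atApex       = contradiction adj ¬Adj-apex-apex

    UnresolvedCycleEdge : ℕ → Set
    UnresolvedCycleEdge a = ∃[ c ] ∃[ c′ ] c < M × c′ < M × CycleAdj c c′ × cdist a c ≡ cdist a c′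

    arc-j≡arc-1+j : arc j ≡ arc (suc j)
    arc-j≡arc-1+j = trans arc-j (sym arc-1+j)

    cycle-unresolved : ∀ {a} → a < M → UnresolvedCycleEdge a
    cycle-unresolved {a} a<M with <-cmp a j
    ... | tri< a<j _ _ = a + j , suc (a + j) , <-trans (n<1+n _) 1+a+j<M , 1+a+j<M , step ,
          (begin
            arc ∣ a - a + j ∣          ≡⟨ cong arc (∣m-m+n∣≡n a j) ⟩
            arc j                      ≡⟨ arc-j≡arc-1+j ⟩
            arc (suc j)                ≡⟨ cong arc (∣m-m+n∣≡n a (suc j)) ⟨
            arc ∣ a - a + suc j ∣      ≡⟨ cong (λ x → arc ∣ a - x ∣) (+-suc a j) ⟩
            arc ∣ a - suc (a + j) ∣    ∎)
      where
        open ≡-Reasoning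
        1+a+j<M : suc (a + j) < M
        1+a+j<M = s≤s (subst (a + j <_) (sym m1≡j+j) (+-monoˡ-< j a<j))
    ... | tri≈ _ refl _ = 0 , m1 , s≤s z≤n , ≤-refl , wrap ,
          (begin
            arc ∣ j - 0 ∣   ≡⟨ cong arc (∣-∣-identityʳ j) ⟩
            arc j           ≡⟨ cong arc m1∸j≡j ⟨
            arc (m1 ∸ j)    ≡⟨ cdist-m1 j≤m1 ⟨
            cdist j m1      ∎)
      where open ≡-Reasoning
    ... | tri> _ _ j<a with m≤n⇒∃[o]m+o≡n j<a
    ...   | e , refl = e , suc e , <-trans (n<1+n e) 1+e<M , 1+e<M , step ,
          (begin
            arc ∣ suc j + e - e ∣     ≡⟨ cong (λ x → arc ∣ x - e ∣) (+-comm (suc j) e) ⟩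
            arc ∣ e + suc j - e ∣     ≡⟨ cong arc (∣m+n-m∣≡n e (suc j)) ⟩
            arc (suc j)               ≡⟨ arc-j≡arc-1+j ⟨
            arc j                     ≡⟨ cong arc (∣m+n-m∣≡n e j) ⟨
            arc ∣ e + j - e ∣         ≡⟨ cong (λ x → arc ∣ x - e ∣) (+-comm e j) ⟩
            arc ∣ j + e - e ∣         ∎)
      where
        open ≡-Reasoning
        1+e<M : suc e < M
        1+e<M = ≤-<-trans (s≤s (m≤n+m e j)) a<M

    unresolved-edge′ : ∀ {a} → a ≤ M → ∃[ b ] ∃[ b′ ] b ≤ M × b′ ≤ M × Adj b b′ × dist′ a b ≡ dist′ a b′
    unresolved-edge′ a≤M with position a≤M
    ... | onCycle a<M with cycle-unresolved a<M
    ...   | c , c′ , c<M , c′<M , c~c′ , eq = c , c′ , <⇒≤ c<M , <⇒≤ c′<M , cycle c~c′ ,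
            trans (dist′-cycle a<M c<M) (trans eq (sym (dist′-cycle a<M c′<M)))
    unresolved-edge′ _ | atApex = j , suc j , <⇒≤ j<M , <⇒≤ 1+j<M , cycle step ,
      trans (dist′-twinˡ 0<j j<M) (trans arc-j≡arc-1+j (sym (dist′-twinˡ (s≤s z≤n) 1+j<M)))
      where
        0<j : 0 < j
        0<j = n≢0⇒n>0 (λ j≡0 → 1+n≢0 (trans m1≡j+j (cong (λ x → x + x) j≡0)))
        1+j<M : suc j < M
        1+j<M = s≤s (subst (suc j ≤_) (sym m1≡j+j) (subst (_≤ j + j) (+-comm j 1) (+-monoʳ-≤ j 0<j)))
        j<M : j < M
        j<M = <-trans (n<1+n j) 1+j<M

    edge-exceptions : ∀ v w → T (adj G v w) →
                       ∃[ X ] ∃[ Y ] ∀ u → dist G u v ≡ dist G u w → toℕ u ≡ X ⊎ toℕ u ≡ Y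
    edge-exceptions v w v~w with edge-exceptions′ (label≤M v) (label≤M w) (adj⇒Adj v~w)
    ... | X , spec = X , M , λ u eq →
      spec (label≤M u) (trans (sym (dist≡dist′ u v)) (trans eq (dist≡dist′ u w)))

    unresolved-edge : ∀ u → ∃[ v ] ∃[ w ] T (adj G v w) × dist G u v ≡ dist G u w
    unresolved-edge u with unresolved-edge′ (label≤M u)
    ... | b , b′ , b≤M , b′≤M , b~b′ , eq with vertex b≤M | vertex b′≤M
    ...   | v , refl | w , refl = v , w , Adj⇒adj b~b′ , trans (dist≡dist′ u v) (trans eq (sym (dist≡dist′ u w)))

open Weights using (ldimF≡1; ldimF≥n/[n∸1]; ldimF≤n/[n∸2])

theorem2 : (p : ℕ) → 3 ≤ p →
    ((k : ℕ) → p ≡ suc (2 * k) → LdimFEq (Toeplitz p (1 ∷ (p ∸ 2) ∷ [])) 1ℚ) ×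
    ((k : ℕ) → p ≡ 2 * k →
      LdimFGeq (Toeplitz p (1 ∷ (p ∸ 2) ∷ [])) (frac p (p ∸ 1)) ×
      LdimFLeq (Toeplitz p (1 ∷ (p ∸ 2) ∷ [])) (frac p (p ∸ 2)))
theorem2 (suc (suc (suc q))) (s≤s (s≤s (s≤s _))) = odd , even
  where
    open Apex q
    odd : ∀ k → p ≡ suc (2 * k) → LdimFEq G 1ℚ
    odd k p≡1+2k = ldimF≡1 G Fin.zero {Fin.zero} {Fin.suc Fin.zero} _ (EvenCycle.0-resolves {k} (suc-injective p≡1+2k))
    even : ∀ k → p ≡ 2 * k → LdimFGeq G (frac p (p ∸ 1)) × LdimFLeq G (frac p (p ∸ 2))
    even (suc j) p≡2+2j = ldimF≥n/[n∸1] G unresolved-edge , ldimF≤n/[n∸2] G edge-exceptions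
      where open OddCycle {j} (trans (suc-injective p≡2+2j) (+-suc j (j + 0)))
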